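{- Let $p$ and $q$ be primes with $p\equiv 5\pmod 8$, $q\equiv 7\pmod 8$ and $\left(\frac{p}{q}\right)=1$. For a square-free integer $m>1$, let $\varepsilon_m$ denote the fundamental unit of $\mathbb{Q}(\sqrt{m})$. \begin{enumerate} \item Let $x,y$ be integers such that $\varepsilon_{2pq}=x+y\sqrt{2pq}$. Then (a) $p(x+1)$ is a square in $\mathbb{N}$; and (b) there exist integers $y_1,y_2$ such that $\sqrt{2\varepsilon_{2pq}}=y_1\sqrt{p}+y_2\sqrt{2q}$ and $2=py_1^2-2qy_2^2$. \item Let $a,b$ be integers such that $\varepsilon_{pq}=a+b\sqrt{pq}$. Then (a) $2p(a+1)$ is a square in $\mathbb{N}$; and (b) there exist integers $b_1,b_2$ such that $\sqrt{\varepsilon_{pq}}=b_1\sqrt{p}+b_2\sqrt{q}$ and $1=pb_1^2-qb_2^2$. \end{enumerate}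
   Context: $\left(\frac{\cdot}{\cdot}\right)$ denotes the Legendre symbol. The fundamental unit $\varepsilon_m$ of the real quadratic field $\mathbb{Q}(\sqrt{m})$ is the generator $>1$ of its unit group modulo $\pm1$. -}

module Defs where

open import Data.Nat as ℕ using (ℕ; _%_)
open import Data.Nat.Primality using (Prime)
open import Data.Nat.Divisibility using (_∣_)
open import Data.Integer.Divisibility using () renaming (_∣_ to _∣ℤ_)
open import Relation.Nullary using (¬_)
open import Data.Integer using (ℤ; +_; _+_; _-_; _*_; -_; _<_; _≤_; 0ℤ; 1ℤ)
open import Data.Product using (_×_; _,_; ∃; ∃-syntax)
open import Data.Sum using (_⊎_)
open import Relation.Binary.PropositionalEquality using (_≡_; _≢_)

-- Elements of ℤ[√m], written (a , b) for a + b√m.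
ℤ[√_] : ℕ → Set
ℤ[√ m ] = ℤ × ℤ

mulQ : (m : ℕ) → ℤ × ℤ → ℤ × ℤ → ℤ × ℤ
mulQ m (a , b) (c , d) = (a * c + (+ m) * (b * d) , a * d + b * c)

oneQ : ℤ × ℤ
oneQ = (1ℤ , 0ℤ)

negQ : ℤ × ℤ → ℤ × ℤ
negQ (a , b) = (- a , - b)

powQ : (m : ℕ) → ℤ × ℤ → ℕ → ℤ × ℤ
powQ m u ℕ.zero    = oneQ
powQ m u (ℕ.suc n) = mulQ m u (powQ m u n)

IsUnitQ : (m : ℕ) → ℤ × ℤ → Set
IsUnitQ m u = ∃[ v ] mulQ m u v ≡ oneQ

-- The real number α√r + β√s is strictly positive (r, s ≥ 1),
-- spelled out with integer comparisons only.
PosComb : (r s : ℕ) → ℤ → ℤ → Set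
PosComb r s α β =
  (0ℤ ≤ α × 0ℤ ≤ β × (0ℤ < α ⊎ 0ℤ < β))
  ⊎ (0ℤ < α × β < 0ℤ × (+ s) * (β * β) < (+ r) * (α * α))
  ⊎ (α < 0ℤ × 0ℤ < β × (+ r) * (α * α) < (+ s) * (β * β))

NonnegComb : (r s : ℕ) → ℤ → ℤ → Set
NonnegComb r s α β = PosComb r s α β ⊎ (α ≡ 0ℤ × β ≡ 0ℤ)

-- a + b√m > 1, i.e. (a-1)√1 + b√m > 0.
Gt1Q : (m : ℕ) → ℤ × ℤ → Set
Gt1Q m (a , b) = PosComb 1 m (a - 1ℤ) b

-- ε = x + y√m is the fundamental unit of ℚ(√m), for m ≡ 2,3 (mod 4)
-- square-free (so the ring of integers is ℤ[√m]): ε > 1 is a unit and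
-- every unit is ±ε^n for some n ∈ ℤ.
IsFundamentalUnit : (m : ℕ) → ℤ × ℤ → Set
IsFundamentalUnit m ε =
  IsUnitQ m ε × Gt1Q m ε ×
  ((u : ℤ × ℤ) → IsUnitQ m u → ∃[ n ]
      (u ≡ powQ m ε n ⊎ u ≡ negQ (powQ m ε n)
       ⊎ mulQ m u (powQ m ε n) ≡ oneQ ⊎ mulQ m u (powQ m ε n) ≡ negQ oneQ))

-- Legendre symbol (a/q) = 1: q ∤ a and a is a square modulo q
-- (∃ t, q ∣ t² - a in ℤ; here q ∣ℤ x means +q divides x).
LegendreOne : ℕ → ℕ → Set
LegendreOne a q = ¬ (q ∣ a) × ∃[ t ] ((+ q) ∣ℤ (+ (t ℕ.* t) - + a))

IsSquareℕ : ℤ → Set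
IsSquareℕ z = ∃[ n ] z ≡ + (n ℕ.* n)

module Submission where

-- The fundamental unit X + Y√m (m = 2pq or pq) has norm 1, as x² + 1 = m y² is impossible mod 8, and
-- X, Y > 0.  For odd X = 2h + 1 and Y = 2z the coprime numbers h + 1 and h multiply to m z², so
-- h + 1 = d u² and h = (m/d) v² for some d ∣ m.  The choice d = 1 gives a smaller solution u + v√m, and
-- every other choice except d = 2p (resp. d = p) is impossible mod 8 or would make −1 or −2 a square
-- mod q ≡ 7 (mod 8); these non-residue facts come from Thue's lemma, and (p/q) = 1 lets p be absorbed
-- into a square.  An even X, possible only for pq, fails the same way.  What remains is
-- X + Y√(2pq) = (u√(2p) + v√q)² with 2pu² − qv² = 1, resp. X + Y√(pq) = (u√p + v√q)² with
-- pu² − qv² = 1, and the claimed identities are read off from these.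

module ResidueRefutation where

  open import Data.Nat
  open import Data.Nat.Properties
  open import Data.Nat.DivMod
  open import Data.Bool using (Bool; true; false; T; not; _∧_)
  open import Data.Unit using (tt)
  open import Data.Empty using (⊥)
  open import Data.List using (List; []; _∷_; _++_; length; map)
  open import Data.List.Relation.Binary.Pointwise using (Pointwise; []; _∷_)
  open import Data.Sum using (inj₁; inj₂)
  open import Relation.Binary.PropositionalEquality

  infixl 6 _⊕_
  infixl 7 _⊗_

  -- Polynomials over ℕ in variables var i, evaluated in an environment list; an equation between
  -- two of them is refuted by checking every residue assignment of its unknowns.
  data Expr : Set where
    var : ℕ → Expr
    con : ℕ → Expr
    _⊕_ _⊗_ : Expr → Expr → Expr

  _!_ : List ℕ → ℕ → ℕ
  []       ! _     = 0
  (x ∷ xs) ! zero  = x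
  (x ∷ xs) ! suc i = xs ! i

  ⟦_⟧ : Expr → List ℕ → ℕ
  ⟦ var i ⟧ ρ = ρ ! i
  ⟦ con c ⟧ ρ = c
  ⟦ e ⊕ f ⟧ ρ = ⟦ e ⟧ ρ + ⟦ f ⟧ ρ
  ⟦ e ⊗ f ⟧ ρ = ⟦ e ⟧ ρ * ⟦ f ⟧ ρ

  _≡[mod_]_ : List ℕ → (M : ℕ) → .{{NonZero M}} → List ℕ → Set
  ρ ≡[mod M ] σ = ∀ i → (ρ ! i) % M ≡ (σ ! i) % M

  ⟦⟧-cong-mod : ∀ M .{{_ : NonZero M}} {ρ σ} → ρ ≡[mod M ] σ → ∀ e → ⟦ e ⟧ ρ % M ≡ ⟦ e ⟧ σ % M
  ⟦⟧-cong-mod M ρ≡σ (var i) = ρ≡σ i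
  ⟦⟧-cong-mod M ρ≡σ (con c) = refl
  ⟦⟧-cong-mod M {ρ} {σ} ρ≡σ (e ⊕ f) = begin
    (⟦ e ⟧ ρ + ⟦ f ⟧ ρ) % M             ≡⟨ %-distribˡ-+ (⟦ e ⟧ ρ) (⟦ f ⟧ ρ) M ⟩
    (⟦ e ⟧ ρ % M + ⟦ f ⟧ ρ % M) % M     ≡⟨ cong₂ (λ a b → (a + b) % M) (⟦⟧-cong-mod M ρ≡σ e) (⟦⟧-cong-mod M ρ≡σ f) ⟩
    (⟦ e ⟧ σ % M + ⟦ f ⟧ σ % M) % M     ≡⟨ %-distribˡ-+ (⟦ e ⟧ σ) (⟦ f ⟧ σ) M ⟨
    (⟦ e ⟧ σ + ⟦ f ⟧ σ) % M             ∎
    where open ≡-Reasoning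
  ⟦⟧-cong-mod M {ρ} {σ} ρ≡σ (e ⊗ f) = begin
    (⟦ e ⟧ ρ * ⟦ f ⟧ ρ) % M             ≡⟨ %-distribˡ-* (⟦ e ⟧ ρ) (⟦ f ⟧ ρ) M ⟩
    (⟦ e ⟧ ρ % M * (⟦ f ⟧ ρ % M)) % M   ≡⟨ cong₂ (λ a b → (a * b) % M) (⟦⟧-cong-mod M ρ≡σ e) (⟦⟧-cong-mod M ρ≡σ f) ⟩
    (⟦ e ⟧ σ % M * (⟦ f ⟧ σ % M)) % M   ≡⟨ %-distribˡ-* (⟦ e ⟧ σ) (⟦ f ⟧ σ) M ⟨
    (⟦ e ⟧ σ * ⟦ f ⟧ σ) % M             ∎
    where open ≡-Reasoning

  reduce-mod : ∀ M .{{_ : NonZero M}} xs {ps rs} → Pointwise (λ p r → p % M ≡ r) ps rs →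
               (xs ++ ps) ≡[mod M ] (map (_% M) xs ++ rs)
  reduce-mod M (x ∷ xs) ps≡rs zero    = sym (m%n%n≡m%n x M)
  reduce-mod M (x ∷ xs) ps≡rs (suc i) = reduce-mod M xs ps≡rs i
  reduce-mod M [] [] i = refl
  reduce-mod M [] (p≡r ∷ ps≡rs) zero    = trans (sym (m%n%n≡m%n _ M)) (cong (_% M) p≡r)
  reduce-mod M [] (p≡r ∷ ps≡rs) (suc i) = reduce-mod M [] ps≡rs i

  all-below : ℕ → (ℕ → Bool) → Bool
  all-below zero    f = true
  all-below (suc k) f = f k ∧ all-below k f

  all-below-sound : ∀ k f → T (all-below k f) → ∀ {i} → i < k → T (f i)
  all-below-sound (suc k) f all {i} i<1+k with f k in fk≡true | m≤n⇒m<n∨m≡n (s≤s⁻¹ i<1+k)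
  ... | true | inj₁ i<k  = all-below-sound k f all i<k
  ... | true | inj₂ refl = subst T (sym fk≡true) tt

  all-residue-lists : (n M : ℕ) → (List ℕ → Bool) → Bool
  all-residue-lists zero    M f = f []
  all-residue-lists (suc n) M f = all-below M (λ r → all-residue-lists n M (λ rs → f (r ∷ rs)))

  all-residue-lists-sound : ∀ M .{{_ : NonZero M}} xs f →
    T (all-residue-lists (length xs) M f) → T (f (map (_% M) xs))
  all-residue-lists-sound M []       f all = all
  all-residue-lists-sound M (x ∷ xs) f all =
    all-residue-lists-sound M xs _ (all-below-sound M _ all (m%n<n x M))

  refute-mod : ∀ M .{{_ : NonZero M}} (L R : Expr) xs ps {rs} → Pointwise (λ p r → p % M ≡ r) ps rs →
    T (all-residue-lists (length xs) M (λ ys → not (⟦ L ⟧ (ys ++ rs) % M ≡ᵇ ⟦ R ⟧ (ys ++ rs) % M))) →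
    ⟦ L ⟧ (xs ++ ps) ≢ ⟦ R ⟧ (xs ++ ps)
  refute-mod M L R xs ps {rs} ps≡rs check L≡R =
    differ (all-residue-lists-sound M xs _ check) (≡⇒≡ᵇ _ _ reduced)
    where
    ρ≡σ : (xs ++ ps) ≡[mod M ] (map (_% M) xs ++ rs)
    ρ≡σ = reduce-mod M xs ps≡rs
    reduced : ⟦ L ⟧ (map (_% M) xs ++ rs) % M ≡ ⟦ R ⟧ (map (_% M) xs ++ rs) % M
    reduced = trans (sym (⟦⟧-cong-mod M ρ≡σ L)) (trans (cong (_% M) L≡R) (⟦⟧-cong-mod M ρ≡σ R))
    differ : ∀ {b} → T (not b) → T b → ⊥
    differ {false} _ ()

module NatEmbedding where

  open import Data.Nat as ℕ using (ℕ)
  open import Data.Integer using (+_; -[1+_]; ∣_∣; _+_; _-_; _*_; 1ℤ)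
  open import Data.Integer.Properties using (pos-+; pos-*)
  open import Data.Integer.Tactic.RingSolver using (solve-∀)
  open import Relation.Binary.PropositionalEquality

  i*i≡∣i∣*∣i∣ : ∀ i → i * i ≡ + (∣ i ∣ ℕ.* ∣ i ∣)
  i*i≡∣i∣*∣i∣ (+ n)    = sym (pos-* n n)
  i*i≡∣i∣*∣i∣ -[1+ n ] = refl

  pos-+-* : ∀ a b c → + (a ℕ.+ b ℕ.* c) ≡ + a + + b * + c
  pos-+-* a b c = trans (pos-+ a (b ℕ.* c)) (cong (λ z → + a + z) (pos-* b c))

  pos-*-+-* : ∀ a b c d → + (a ℕ.* b ℕ.+ c ℕ.* d) ≡ + a * + b + + c * + d
  pos-*-+-* a b c d = trans (pos-+ (a ℕ.* b) (c ℕ.* d)) (cong₂ _+_ (pos-* a b) (pos-* c d))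

  pos-*-+1 : ∀ c a → + c * (+ a + 1ℤ) ≡ + (c ℕ.* (a ℕ.+ 1))
  pos-*-+1 c a = trans (cong (+ c *_) (sym (pos-+ a 1))) (sym (pos-* c (a ℕ.+ 1)))

  pos-weighted-square : ∀ c a → + (c ℕ.* (a ℕ.* a)) ≡ + c * (+ a * + a)
  pos-weighted-square c a = trans (pos-* c (a ℕ.* a)) (cong (+ c *_) (pos-* a a))

  pos-difference : ∀ {k a b} → a ≡ k ℕ.+ b → + k ≡ + a - + b
  pos-difference {k} {a} {b} a≡k+b = sym (trans (cong (λ z → + z - + b) a≡k+b) (trans (cong (_- + b) (pos-+ k b)) (cancel (+ k) (+ b))))
    where
    cancel : ∀ K B → K + B - B ≡ K
    cancel = solve-∀

module Thue where

  open NatEmbedding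
  open import Data.Nat as ℕ
  open import Data.Nat.Properties
  open import Data.Nat.DivMod
  open import Data.Nat.Divisibility
  open import Data.Nat.Primality
  open import Data.Integer as ℤ using (ℤ; +_; ∣_∣)
  import Data.Integer.Properties as ℤ
  import Data.Integer.Divisibility.Signed as ℤ
  open import Data.Integer.Tactic.RingSolver using (solve-∀)
  open import Data.Fin as Fin using (Fin; toℕ; fromℕ<)
  import Data.Fin.Properties as Fin
  open import Data.Product using (∃₂; ∃-syntax; _×_; _,_; proj₁; proj₂; uncurry)
  open import Data.Sum using (_⊎_; inj₁; inj₂)
  open import Data.Empty using (⊥-elim)
  open import Relation.Binary.PropositionalEquality
  open import Relation.Nullary using (yes; no)
  open import Function using (_∘_)

  integer-sqrt : ∀ n → ∃[ k ] k * k ≤ n × n < suc k * suc k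
  integer-sqrt zero = 0 , z≤n , s≤s z≤n
  integer-sqrt (suc n) with integer-sqrt n
  ... | k , k²≤n , n<[1+k]² with m≤n⇒m<n∨m≡n n<[1+k]²
  ... | inj₁ 1+n<[1+k]² = k , m≤n⇒m≤1+n k²≤n , 1+n<[1+k]²
  ... | inj₂ 1+n≡[1+k]² = suc k , ≤-reflexive (sym 1+n≡[1+k]²) ,
        subst (_< suc (suc k) * suc (suc k)) (sym 1+n≡[1+k]²) (*-mono-< (n<1+n (suc k)) (n<1+n (suc k)))

  prime⇒non-square : ∀ {q} x → Prime q → x * x ≢ q
  prime⇒non-square {q} x q-prime x²≡q with prime⇒irreducible q-prime (divides x (sym x²≡q))
  ... | inj₁ refl = ¬prime[1] (subst Prime (sym x²≡q) q-prime)
  ... | inj₂ refl = ¬prime[1] (subst Prime (*-cancelʳ-≡ x 1 x (trans x²≡q (sym (*-identityˡ x)))) q-prime)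
    where instance _ = prime⇒nonZero q-prime

  %-≡⇒∣- : ∀ a b q .{{_ : NonZero q}} → a % q ≡ b % q → + q ℤ.∣ + a ℤ.- + b
  %-≡⇒∣- a b q a≡b = ℤ.divides (+ (a / q) ℤ.- + (b / q)) (begin
    + a ℤ.- + b                                    ≡⟨ cong₂ (λ a b → + a ℤ.- + b) (m≡m%n+[m/n]*n a q) (m≡m%n+[m/n]*n b q) ⟩
    + (a % q + a / q * q) ℤ.- + (b % q + b / q * q) ≡⟨ cong₂ ℤ._-_ (pos-+-* (a % q) (a / q) q) (pos-+-* (b % q) (b / q) q) ⟩
    (+ (a % q) ℤ.+ + (a / q) ℤ.* + q) ℤ.- (+ (b % q) ℤ.+ + (b / q) ℤ.* + q)
      ≡⟨ cong (λ r → (+ r ℤ.+ + (a / q) ℤ.* + q) ℤ.- (+ (b % q) ℤ.+ + (b / q) ℤ.* + q)) a≡b ⟩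
    (+ (b % q) ℤ.+ + (a / q) ℤ.* + q) ℤ.- (+ (b % q) ℤ.+ + (b / q) ℤ.* + q)
      ≡⟨ cancel (+ (b % q)) (+ (a / q)) (+ (b / q)) (+ q) ⟩
    (+ (a / q) ℤ.- + (b / q)) ℤ.* + q                              ∎)
    where
    open ≡-Reasoning
    cancel : ∀ R A B Q → (R ℤ.+ A ℤ.* Q) ℤ.- (R ℤ.+ B ℤ.* Q) ≡ (A ℤ.- B) ℤ.* Q
    cancel = solve-∀

  ∣+m-+n∣≤ : ∀ {m n k} → m ≤ k → n ≤ k → ∣ + m ℤ.- + n ∣ ≤ k
  ∣+m-+n∣≤ {m} {n} m≤k n≤k =
    subst (_≤ _) (cong ∣_∣ (sym (ℤ.m-n≡m⊖n m n))) (≤-trans (ℤ.∣m⊝n∣≤m⊔n m n) (⊔-lub m≤k n≤k))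

  ∣+m-+n∣≡0⇒m≡n : ∀ {m n} → ∣ + m ℤ.- + n ∣ ≡ 0 → m ≡ n
  ∣+m-+n∣≡0⇒m≡n {m} {n} eq = ℤ.+-injective (ℤ.i-j≡0⇒i≡j (+ m) (+ n) (ℤ.∣i∣≡0⇒i≡0 eq))

  ∣x+ty∧∣t²+c⇒∣x²+cy² : ∀ {d} X Y T C → d ℤ.∣ X ℤ.+ T ℤ.* Y → d ℤ.∣ T ℤ.* T ℤ.+ C → d ℤ.∣ X ℤ.* X ℤ.+ C ℤ.* (Y ℤ.* Y)
  ∣x+ty∧∣t²+c⇒∣x²+cy² {d} X Y T C d∣X+TY d∣T²+C = subst (d ℤ.∣_) (factor X Y T C)
    (ℤ.∣m∣n⇒∣m+n (ℤ.∣m⇒∣m*n (X ℤ.- T ℤ.* Y) d∣X+TY) (ℤ.∣n⇒∣m*n (Y ℤ.* Y) d∣T²+C))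
    where
    factor : ∀ X Y T C → (X ℤ.+ T ℤ.* Y) ℤ.* (X ℤ.- T ℤ.* Y) ℤ.+ (Y ℤ.* Y) ℤ.* (T ℤ.* T ℤ.+ C) ≡ X ℤ.* X ℤ.+ C ℤ.* (Y ℤ.* Y)
    factor = solve-∀

  pigeonhole-pairs : ∀ {q} t k .{{_ : NonZero q}} → q < suc k * suc k →
    ∃[ i₁ ] ∃[ j₁ ] ∃[ i₂ ] ∃[ j₂ ] i₁ ≤ k × j₁ ≤ k × i₂ ≤ k × j₂ ≤ k × (i₁ ≢ i₂ ⊎ j₁ ≢ j₂) ×
      (i₁ + t * j₁) % q ≡ (i₂ + t * j₂) % q
  pigeonhole-pairs {q} t k q<n² =
    i₁ , j₁ , i₂ , j₂ , ≤k (proj₁ (coords P₁)) , ≤k (proj₂ (coords P₁)) , ≤k (proj₁ (coords P₂)) , ≤k (proj₂ (coords P₂)) ,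
    distinct , value-≡
    where
    n : ℕ
    n = suc k
    coords : Fin (n * n) → Fin n × Fin n
    coords = Fin.remQuot n
    value : Fin (n * n) → ℕ
    value P = toℕ (proj₁ (coords P)) + t * toℕ (proj₂ (coords P))
    residue : Fin (n * n) → Fin q
    residue P = fromℕ< (m%n<n (value P) q)
    collision : ∃₂ λ P₁ P₂ → P₁ Fin.< P₂ × residue P₁ ≡ residue P₂
    collision = Fin.pigeonhole q<n² residue
    P₁ P₂ : Fin (n * n)
    P₁ = proj₁ collision
    P₂ = proj₁ (proj₂ collision)
    i₁ j₁ i₂ j₂ : ℕ
    i₁ = toℕ (proj₁ (coords P₁))
    j₁ = toℕ (proj₂ (coords P₁))
    i₂ = toℕ (proj₁ (coords P₂))
    j₂ = toℕ (proj₂ (coords P₂))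
    ≤k : (i : Fin n) → toℕ i ≤ k
    ≤k = Fin.toℕ≤pred[n]
    value-≡ : value P₁ % q ≡ value P₂ % q
    value-≡ = trans (sym (Fin.toℕ-fromℕ< _)) (trans (cong toℕ (proj₂ (proj₂ (proj₂ collision)))) (Fin.toℕ-fromℕ< _))
    P₁≡P₂ : i₁ ≡ i₂ → j₁ ≡ j₂ → P₁ ≡ P₂
    P₁≡P₂ i₁≡i₂ j₁≡j₂ = begin
      P₁                              ≡⟨ Fin.combine-remQuot n P₁ ⟨
      uncurry Fin.combine (coords P₁) ≡⟨ cong (uncurry Fin.combine) (cong₂ _,_ (Fin.toℕ-injective i₁≡i₂) (Fin.toℕ-injective j₁≡j₂)) ⟩
      uncurry Fin.combine (coords P₂) ≡⟨ Fin.combine-remQuot n P₂ ⟩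
      P₂                              ∎
      where open ≡-Reasoning
    distinct : i₁ ≢ i₂ ⊎ j₁ ≢ j₂
    distinct with i₁ ≟ i₂ | j₁ ≟ j₂
    ... | no i₁≢i₂ | _        = inj₁ i₁≢i₂
    ... | yes _    | no j₁≢j₂ = inj₂ j₁≢j₂
    ... | yes i₁≡i₂ | yes j₁≡j₂ = ⊥-elim (<-irrefl (cong toℕ (P₁≡P₂ i₁≡i₂ j₁≡j₂)) (proj₁ (proj₂ (proj₂ collision))))

  -- For k = ⌊√q⌋ two of the (k+1)² > q pairs (i, j) collide; their differences X ≡ −t Y give q ∣ X² + c Y².
  thue : ∀ {q t c} → Prime q → q ∣ t * t + c →
    ∃[ x ] ∃[ y ] x * x < q × y * y < q × q ∣ x * x + c * (y * y) × (x ≢ 0 ⊎ y ≢ 0)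
  thue {q} {t} {c} q-prime q∣t²+c with integer-sqrt q
  ... | k , k²≤q , q<[1+k]² = from-pairs (pigeonhole-pairs t k q<[1+k]²)
    where
    instance _ = prime⇒nonZero q-prime
    sq< : ∀ z → z ≤ k → z * z < q
    sq< z z≤k with m≤n⇒m<n∨m≡n (≤-trans (*-mono-≤ z≤k z≤k) k²≤q)
    ... | inj₁ z²<q = z²<q
    ... | inj₂ z²≡q = ⊥-elim (prime⇒non-square z q-prime z²≡q)
    from-pairs : ∃[ i₁ ] ∃[ j₁ ] ∃[ i₂ ] ∃[ j₂ ] i₁ ≤ k × j₁ ≤ k × i₂ ≤ k × j₂ ≤ k × (i₁ ≢ i₂ ⊎ j₁ ≢ j₂) ×
                   (i₁ + t * j₁) % q ≡ (i₂ + t * j₂) % q →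
                 ∃[ x ] ∃[ y ] x * x < q × y * y < q × q ∣ x * x + c * (y * y) × (x ≢ 0 ⊎ y ≢ 0)
    from-pairs (i₁ , j₁ , i₂ , j₂ , i₁≤k , j₁≤k , i₂≤k , j₂≤k , distinct , value-≡) =
      x , y , sq< x (∣+m-+n∣≤ i₁≤k i₂≤k) , sq< y (∣+m-+n∣≤ j₁≤k j₂≤k) , q∣x²+cy² , nontrivial distinct
      where
      X Y T C : ℤ
      X = + i₁ ℤ.- + i₂
      Y = + j₁ ℤ.- + j₂
      T = + t
      C = + c
      x y : ℕ
      x = ∣ X ∣
      y = ∣ Y ∣
      q∣X+TY : + q ℤ.∣ X ℤ.+ T ℤ.* Y
      q∣X+TY = subst (+ q ℤ.∣_) (trans (cong₂ ℤ._-_ (pos-+-* i₁ t j₁) (pos-+-* i₂ t j₂)) (regroup (+ i₁) (+ i₂) (+ j₁) (+ j₂) T))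
                     (%-≡⇒∣- (i₁ + t * j₁) (i₂ + t * j₂) q value-≡)
        where
        regroup : ∀ I₁ I₂ J₁ J₂ T → (I₁ ℤ.+ T ℤ.* J₁) ℤ.- (I₂ ℤ.+ T ℤ.* J₂) ≡ (I₁ ℤ.- I₂) ℤ.+ T ℤ.* (J₁ ℤ.- J₂)
        regroup = solve-∀
      q∣T²+C : + q ℤ.∣ T ℤ.* T ℤ.+ C
      q∣T²+C = subst (+ q ℤ.∣_) (trans (ℤ.pos-+ (t * t) c) (cong (ℤ._+ C) (ℤ.pos-* t t))) (ℤ.∣ᵤ⇒∣ q∣t²+c)
      q∣x²+cy² : q ∣ x * x + c * (y * y)
      q∣x²+cy² = ℤ.∣⇒∣ᵤ (subst (+ q ℤ.∣_) to-ℕ (∣x+ty∧∣t²+c⇒∣x²+cy² X Y T C q∣X+TY q∣T²+C))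
        where
        to-ℕ : X ℤ.* X ℤ.+ C ℤ.* (Y ℤ.* Y) ≡ + (x * x + c * (y * y))
        to-ℕ = trans (cong₂ (λ a b → a ℤ.+ C ℤ.* b) (i*i≡∣i∣*∣i∣ X) (i*i≡∣i∣*∣i∣ Y)) (sym (pos-+-* (x * x) c (y * y)))
      nontrivial : i₁ ≢ i₂ ⊎ j₁ ≢ j₂ → x ≢ 0 ⊎ y ≢ 0
      nontrivial (inj₁ i₁≢i₂) = inj₁ (i₁≢i₂ ∘ ∣+m-+n∣≡0⇒m≡n)
      nontrivial (inj₂ j₁≢j₂) = inj₂ (j₁≢j₂ ∘ ∣+m-+n∣≡0⇒m≡n)

module QuadraticNonresidues where

  open ResidueRefutation
  open Thue
  open import Data.Nat
  open import Data.Nat.Properties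
  open import Data.Nat.Divisibility
  open import Data.Nat.Primality
  open import Data.Nat.Tactic.RingSolver using (solve-∀)
  open import Data.Product using (∃-syntax; _×_; _,_)
  open import Data.Sum using (_⊎_; inj₁; inj₂)
  open import Data.List using ([]; _∷_)
  open import Data.List.Relation.Binary.Pointwise using ([]; _∷_)
  open import Relation.Binary.PropositionalEquality
  open import Relation.Nullary using (¬_)
  open import Data.Empty using (⊥)

  even-or-odd : ∀ n → (∃[ h ] n ≡ 2 * h) ⊎ (∃[ h ] n ≡ 2 * h + 1)
  even-or-odd zero = inj₁ (0 , refl)
  even-or-odd (suc n) with even-or-odd n
  ... | inj₁ (h , refl) = inj₂ (h , +-comm 1 (2 * h))
  ... | inj₂ (h , refl) = inj₁ (suc h , shift h)
    where
    shift : ∀ h → 1 + (2 * h + 1) ≡ 2 * (1 + h)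
    shift = solve-∀

  m*m≡0⇒m≡0 : ∀ m → m * m ≡ 0 → m ≡ 0
  m*m≡0⇒m≡0 m m²≡0 with m*n≡0⇒m≡0∨n≡0 m m²≡0
  ... | inj₁ m≡0 = m≡0
  ... | inj₂ m≡0 = m≡0

  thue-multiple : ∀ {q t c} .{{_ : NonZero c}} → Prime q → q ∣ t * t + c →
    ∃[ x ] ∃[ y ] ∃[ s ] x * x + c * (y * y) ≡ s * q × 0 < s × s ≤ c
  thue-multiple {q} {t} {c} q-prime q∣t²+c = bound (thue {q} {t} {c} q-prime q∣t²+c)
    where
    instance _ = prime⇒nonZero q-prime
    bound : ∃[ x ] ∃[ y ] x * x < q × y * y < q × q ∣ x * x + c * (y * y) × (x ≢ 0 ⊎ y ≢ 0) →
            ∃[ x ] ∃[ y ] ∃[ s ] x * x + c * (y * y) ≡ s * q × 0 < s × s ≤ c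
    bound (x , y , x²<q , y²<q , divides s x²+cy²≡sq , nontrivial) = x , y , s , x²+cy²≡sq , 0<s nontrivial , s≤c
      where
      s≤c : s ≤ c
      s≤c = s≤s⁻¹ (*-cancelʳ-< _ s (suc c)
              (subst (_< suc c * q) x²+cy²≡sq (+-mono-<-≤ x²<q (*-monoʳ-≤ c (<⇒≤ y²<q)))))
      x²+cy²≡0 : s ≡ 0 → x * x + c * (y * y) ≡ 0
      x²+cy²≡0 s≡0 = trans x²+cy²≡sq (cong (_* q) s≡0)
      0<s : x ≢ 0 ⊎ y ≢ 0 → 0 < s
      0<s (inj₁ x≢0) = n≢0⇒n>0 λ s≡0 → x≢0 (m*m≡0⇒m≡0 x (m+n≡0⇒m≡0 (x * x) (x²+cy²≡0 s≡0)))
      0<s (inj₂ y≢0) = n≢0⇒n>0 λ s≡0 →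
        y≢0 (m*m≡0⇒m≡0 y (m*n≡0⇒m≡0 (y * y) c (trans (*-comm (y * y) c) (m+n≡0⇒n≡0 (x * x) (x²+cy²≡0 s≡0)))))

  -- By Thue, x² + y² = q for some x, y, which is impossible mod 8.
  q≡7⇒q∤w²+1 : ∀ {q} w → Prime q → q % 8 ≡ 7 → ¬ q ∣ w * w + 1
  q≡7⇒q∤w²+1 {q} w q-prime q≡7 q∣w²+1 = impossible (thue-multiple {q} {w} {1} q-prime q∣w²+1)
    where
    impossible : ∃[ x ] ∃[ y ] ∃[ s ] x * x + 1 * (y * y) ≡ s * q × 0 < s × s ≤ 1 → ⊥
    impossible (x , y , 1 , x²+y²≡q , _) =
      refute-mod 8 (var 0 ⊗ var 0 ⊕ con 1 ⊗ (var 1 ⊗ var 1)) (con 1 ⊗ var 2) (x ∷ y ∷ []) (q ∷ []) (q≡7 ∷ []) _ x²+y²≡q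
    impossible (_ , _ , 0 , _ , () , _)
    impossible (_ , _ , suc (suc _) , _ , _ , s≤s ())

  no-x²+2y²≡2q : ∀ x y q → q % 8 ≡ 7 → x * x + 2 * (y * y) ≢ 2 * q
  no-x²+2y²≡2q x y q q≡7 with even-or-odd x
  ... | inj₂ (a , refl) =
    refute-mod 8 ((con 2 ⊗ var 0 ⊕ con 1) ⊗ (con 2 ⊗ var 0 ⊕ con 1) ⊕ con 2 ⊗ (var 1 ⊗ var 1)) (con 2 ⊗ var 2)
      (a ∷ y ∷ []) (q ∷ []) (q≡7 ∷ []) _
  ... | inj₁ (a , refl) = λ 4a²+2y²≡2q →
    refute-mod 8 (var 1 ⊗ var 1 ⊕ con 2 ⊗ (var 0 ⊗ var 0)) (var 2) (a ∷ y ∷ []) (q ∷ []) (q≡7 ∷ []) _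
      (*-cancelˡ-≡ _ _ 2 (trans (halve a y) 4a²+2y²≡2q))
    where
    halve : ∀ a y → 2 * (y * y + 2 * (a * a)) ≡ 2 * a * (2 * a) + 2 * (y * y)
    halve = solve-∀

  -- By Thue, x² + 2y² is q or 2q, both impossible mod 8.
  q≡7⇒q∤w²+2 : ∀ {q} w → Prime q → q % 8 ≡ 7 → ¬ q ∣ w * w + 2
  q≡7⇒q∤w²+2 {q} w q-prime q≡7 q∣w²+2 = impossible (thue-multiple {q} {w} {2} q-prime q∣w²+2)
    where
    impossible : ∃[ x ] ∃[ y ] ∃[ s ] x * x + 2 * (y * y) ≡ s * q × 0 < s × s ≤ 2 → ⊥
    impossible (x , y , 1 , x²+2y²≡q , _) =
      refute-mod 8 (var 0 ⊗ var 0 ⊕ con 2 ⊗ (var 1 ⊗ var 1)) (con 1 ⊗ var 2) (x ∷ y ∷ []) (q ∷ []) (q≡7 ∷ []) _ x²+2y²≡q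
    impossible (x , y , 2 , x²+2y²≡2q , _) = no-x²+2y²≡2q x y q q≡7 x²+2y²≡2q
    impossible (_ , _ , 0 , _ , () , _)
    impossible (_ , _ , suc (suc (suc _)) , _ , _ , s≤s (s≤s ()))

module CoprimeFactorisation where

  open import Data.Nat
  open import Data.Nat.Properties
  open import Data.Nat.Divisibility
  open import Data.Nat.Primality
  open import Data.Nat.GCD
  open import Data.Nat.Coprimality as Coprime using (Coprime)
  open import Data.Nat.ListAction using (product)
  open import Data.Nat.Tactic.RingSolver using (solve-∀)
  open import Data.Bool using (Bool; true; false; not)
  open import Data.List using (List; []; _∷_; length)
  open import Data.List.Relation.Unary.All using (All; []; _∷_)
  open import Data.Vec as Vec using (Vec; []; _∷_)
  open import Data.Product using (∃-syntax; _×_; _,_)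
  open import Data.Sum using (_⊎_; inj₁; inj₂)
  open import Data.Empty using (⊥-elim)
  open import Relation.Binary.PropositionalEquality
  open import Relation.Binary.Definitions using (tri<; tri≈; tri>)

  m*m≡n*n⇒m≡n : ∀ {m n} → m * m ≡ n * n → m ≡ n
  m*m≡n*n⇒m≡n {m} {n} m²≡n² with <-cmp m n
  ... | tri< m<n _ _ = ⊥-elim (<-irrefl m²≡n² (*-mono-< m<n m<n))
  ... | tri≈ _ m≡n _ = m≡n
  ... | tri> _ _ n<m = ⊥-elim (<-irrefl (sym m²≡n²) (*-mono-< n<m n<m))

  gcd[m,z]²≡m : ∀ {m n z} → Coprime m n → m * n ≡ z * z → gcd m z * gcd m z ≡ m
  gcd[m,z]²≡m {m} {n} {z} m⊥n mn≡z² = begin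
    g * g                                             ≡⟨ c*gcd[m,n]≡gcd[cm,cn] g m z ⟩
    gcd (g * m) (g * z)                               ≡⟨ cong₂ gcd (*-comm g m) (*-comm g z) ⟩
    gcd (m * g) (z * g)                               ≡⟨ cong₂ gcd (c*gcd[m,n]≡gcd[cm,cn] m m z) (c*gcd[m,n]≡gcd[cm,cn] z m z) ⟩
    gcd (gcd (m * m) (m * z)) (gcd (z * m) (z * z))   ≡⟨ cong (λ w → gcd (gcd (m * m) (m * z)) (gcd w (z * z))) (*-comm z m) ⟩
    gcd (gcd (m * m) (m * z)) (gcd (m * z) (z * z))   ≡⟨ cong (λ w → gcd (gcd (m * m) (m * z)) (gcd (m * z) w)) mn≡z² ⟨
    gcd (gcd (m * m) (m * z)) (gcd (m * z) (m * n))   ≡⟨ cong₂ gcd (c*gcd[m,n]≡gcd[cm,cn] m m z) (c*gcd[m,n]≡gcd[cm,cn] m z n) ⟨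
    gcd (m * g) (m * gcd z n)                         ≡⟨ c*gcd[m,n]≡gcd[cm,cn] m g (gcd z n) ⟨
    m * gcd g (gcd z n)                               ≡⟨ cong (m *_) (Coprime.coprime⇒gcd≡1 coprime) ⟩
    m * 1                                             ≡⟨ *-identityʳ m ⟩
    m                                                 ∎
    where
    open ≡-Reasoning
    g : ℕ
    g = gcd m z
    coprime : Coprime g (gcd z n)
    coprime (d∣g , d∣gcd[z,n]) = m⊥n (∣-trans d∣g (gcd[m,n]∣m m z) , ∣-trans d∣gcd[z,n] (gcd[m,n]∣n z n))

  coprime-product-square : ∀ {m n z} → Coprime m n → m * n ≡ z * z →
    ∃[ u ] ∃[ v ] m ≡ u * u × n ≡ v * v × z ≡ u * v
  coprime-product-square {m} {n} {z} m⊥n mn≡z² =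
    gcd m z , gcd n z , sym m≡u² , sym n≡v² , m*m≡n*n⇒m≡n (trans (sym mn≡z²) (trans (sym (cong₂ _*_ m≡u² n≡v²)) (interchange (gcd m z) (gcd n z))))
    where
    m≡u² : gcd m z * gcd m z ≡ m
    m≡u² = gcd[m,z]²≡m m⊥n mn≡z²
    n≡v² : gcd n z * gcd n z ≡ n
    n≡v² = gcd[m,z]²≡m (Coprime.sym m⊥n) (trans (*-comm n m) mn≡z²)
    interchange : ∀ u v → (u * u) * (v * v) ≡ (u * v) * (u * v)
    interchange = solve-∀

  coprime-prime-split : ∀ {r m n c} → Prime r → Coprime m n → m * n ≡ r * c →
    (∃[ m′ ] m ≡ r * m′ × Coprime m′ n × m′ * n ≡ c) ⊎ (∃[ n′ ] n ≡ r * n′ × Coprime m n′ × m * n′ ≡ c)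
  coprime-prime-split {r} {m} {n} {c} r-prime m⊥n mn≡rc
    with euclidsLemma m n r-prime (divides c (trans mn≡rc (*-comm r c)))
  ... | inj₁ (divides m′ refl) = inj₁ (m′ , *-comm m′ r ,
          (λ (d∣m′ , d∣n) → m⊥n (∣-trans d∣m′ (m∣m*n r) , d∣n)) ,
          *-cancelˡ-≡ (m′ * n) c r (trans (regroup r m′ n) mn≡rc))
    where
    instance _ = prime⇒nonZero r-prime
    regroup : ∀ r m′ n → r * (m′ * n) ≡ m′ * r * n
    regroup = solve-∀
  ... | inj₂ (divides n′ refl) = inj₂ (n′ , *-comm n′ r ,
          (λ (d∣m , d∣n′) → m⊥n (d∣m , ∣-trans d∣n′ (m∣m*n r))) ,
          *-cancelˡ-≡ (m * n′) c r (trans (regroup r m n′) mn≡rc))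
    where
    instance _ = prime⇒nonZero r-prime
    regroup : ∀ r m n′ → r * (m * n′) ≡ m * (n′ * r)
    regroup = solve-∀

  subproduct : (rs : List ℕ) → Vec Bool (length rs) → ℕ
  subproduct []       []           = 1
  subproduct (r ∷ rs) (true ∷ bs)  = r * subproduct rs bs
  subproduct (r ∷ rs) (false ∷ bs) = subproduct rs bs

  SplitsIntoSquares : List ℕ → ℕ → ℕ → ℕ → Set
  SplitsIntoSquares rs m n z =
    ∃[ bs ] ∃[ u ] ∃[ v ] m ≡ subproduct rs bs * (u * u) × n ≡ subproduct rs (Vec.map not bs) * (v * v) × z ≡ u * v

  coprime-product-split : ∀ rs {m n c} → All Prime rs → Coprime m n → m * n ≡ product rs * c →
    ∃[ bs ] ∃[ m′ ] ∃[ n′ ] m ≡ subproduct rs bs * m′ × n ≡ subproduct rs (Vec.map not bs) * n′ ×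
      Coprime m′ n′ × m′ * n′ ≡ c
  coprime-product-split [] {m} {n} {c} [] m⊥n mn≡c =
    [] , m , n , sym (*-identityˡ m) , sym (*-identityˡ n) , m⊥n , trans mn≡c (*-identityˡ c)
  coprime-product-split (r ∷ rs) {c = c} (r-prime ∷ rs-prime) m⊥n mn≡rc
    with coprime-prime-split r-prime m⊥n (trans mn≡rc (*-assoc r (product rs) c))
  ... | inj₁ (m₁ , refl , m₁⊥n , m₁n≡c) with coprime-product-split rs rs-prime m₁⊥n m₁n≡c
  ...   | bs , m′ , n′ , refl , n≡ , m′⊥n′ , m′n′≡c =
    true ∷ bs , m′ , n′ , sym (*-assoc r _ m′) , n≡ , m′⊥n′ , m′n′≡c
  coprime-product-split (r ∷ rs) (r-prime ∷ rs-prime) m⊥n mn≡rc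
      | inj₂ (n₁ , refl , m⊥n₁ , mn₁≡c) with coprime-product-split rs rs-prime m⊥n₁ mn₁≡c
  ...   | bs , m′ , n′ , m≡ , refl , m′⊥n′ , m′n′≡c =
    false ∷ bs , m′ , n′ , m≡ , sym (*-assoc r _ n′) , m′⊥n′ , m′n′≡c

  coprime-product-square-split : ∀ rs {m n z} → All Prime rs → Coprime m n → m * n ≡ product rs * (z * z) →
    SplitsIntoSquares rs m n z
  coprime-product-square-split rs {z = z} rs-prime m⊥n mn≡ with coprime-product-split rs rs-prime m⊥n mn≡
  ... | bs , m′ , n′ , refl , refl , m′⊥n′ , m′n′≡z² with coprime-product-square {z = z} m′⊥n′ m′n′≡z²
  ...   | u , v , refl , refl , z≡uv = bs , u , v , refl , refl , z≡uv

  0<product : ∀ {rs} → All Prime rs → 0 < product rs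
  0<product [] = z<s
  0<product {r ∷ _} (r-prime ∷ rs-prime) = *-mono-< (>-nonZero⁻¹ r {{prime⇒nonZero r-prime}}) (0<product rs-prime)

  coprime-suc : ∀ h → Coprime (suc h) h
  coprime-suc h = subst (λ a → Coprime a h) (+-comm h 1) (Coprime.coprime-+ (Coprime.1-coprimeTo h))

  coprime-odd-+2 : ∀ w → Coprime (2 * w + 1 + 2) (2 * w + 1)
  coprime-odd-+2 w = Coprime.coprime-+ λ (d∣2 , d∣2w+1) → ∣1⇒≡1 (∣m+n∣m⇒∣n d∣2w+1 (∣-trans d∣2 (m∣m*n w)))

module LegendreTransfer where

  open import Defs
  open import Data.Nat as ℕ using (ℕ)
  open import Data.Nat.Divisibility using (_∣_)
  open import Data.Integer using (+_; _+_; _-_; _*_)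
  open import Data.Integer.Properties using (pos-+; pos-*)
  import Data.Integer.Divisibility.Signed as ℤ
  open import Data.Integer.Tactic.RingSolver using (solve-∀)
  open import Data.Product using (∃-syntax; _,_)
  open import Relation.Binary.PropositionalEquality

  -- With t² ≡ p (mod q), the witness is w = t v.
  legendre-transfer : ∀ {p q} → LegendreOne p q → ∀ v c → q ∣ p ℕ.* (v ℕ.* v) ℕ.+ c → ∃[ w ] q ∣ w ℕ.* w ℕ.+ c
  legendre-transfer {p} {q} (_ , t , q∣t²-p) v c q∣pv²+c = t ℕ.* v , ℤ.∣⇒∣ᵤ (subst (+ q ℤ.∣_) (sym tv²+c≡)
    (ℤ.∣m∣n⇒∣m+n (ℤ.∣m⇒∣m*n (+ (v ℕ.* v)) (ℤ.∣ᵤ⇒∣ {+ q} {+ (t ℕ.* t) - + p} q∣t²-p)) (ℤ.∣ᵤ⇒∣ {+ q} {+ (p ℕ.* (v ℕ.* v) ℕ.+ c)} q∣pv²+c)))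
    where
    open ≡-Reasoning
    split : ∀ T V P C → (T * V) * (T * V) + C ≡ (T * T - P) * (V * V) + (P * (V * V) + C)
    split = solve-∀
    tv²+c≡ : + (t ℕ.* v ℕ.* (t ℕ.* v) ℕ.+ c) ≡ (+ (t ℕ.* t) - + p) * + (v ℕ.* v) + + (p ℕ.* (v ℕ.* v) ℕ.+ c)
    tv²+c≡ = begin
      + (t ℕ.* v ℕ.* (t ℕ.* v) ℕ.+ c)                       ≡⟨ pos-+ _ c ⟩
      + (t ℕ.* v ℕ.* (t ℕ.* v)) + + c                       ≡⟨ cong (_+ + c) (trans (pos-* (t ℕ.* v) _) (cong₂ _*_ (pos-* t v) (pos-* t v))) ⟩
      (+ t * + v) * (+ t * + v) + + c                       ≡⟨ split (+ t) (+ v) (+ p) (+ c) ⟩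
      (+ t * + t - + p) * (+ v * + v) + (+ p * (+ v * + v) + + c)
        ≡⟨ cong₂ (λ a b → (a - + p) * b + (+ p * b + + c)) (pos-* t t) (pos-* v v) ⟨
      (+ (t ℕ.* t) - + p) * + (v ℕ.* v) + (+ p * + (v ℕ.* v) + + c)
        ≡⟨ cong (λ z → (+ (t ℕ.* t) - + p) * + (v ℕ.* v) + z) (trans (pos-+ _ c) (cong (_+ + c) (pos-* p _))) ⟨
      (+ (t ℕ.* t) - + p) * + (v ℕ.* v) + + (p ℕ.* (v ℕ.* v) ℕ.+ c)   ∎

module PellUnits where

  open import Defs
  open NatEmbedding
  open import Data.Nat as ℕ using (ℕ; zero; suc; s≤s; z<s)
  import Data.Nat.Properties as ℕ
  open import Data.Integer as ℤ using (ℤ; +_; -[1+_]; +[1+_]; ∣_∣; _+_; _-_; _*_; -_; 0ℤ; 1ℤ; -1ℤ; +<+)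
  import Data.Integer.Properties as ℤ
  open import Data.Integer.Tactic.RingSolver using (solve-∀)
  open import Data.Product using (∃-syntax; _×_; _,_; proj₁; proj₂)
  open import Data.Sum using (_⊎_; inj₁; inj₂; [_,_]′)
  open import Data.Empty using (⊥; ⊥-elim)
  open import Relation.Binary.PropositionalEquality

  record LeastPellSolution (m X Y : ℕ) : Set where
    field
      pell  : X ℕ.* X ≡ 1 ℕ.+ m ℕ.* (Y ℕ.* Y)
      Y>0   : 0 ℕ.< Y
      least : ∀ {u v} → u ℕ.* u ≡ 1 ℕ.+ m ℕ.* (v ℕ.* v) → 0 ℕ.< v → X ℕ.≤ u

  NegativePellInsoluble : ℕ → Set
  NegativePellInsoluble m = ∀ a b → a ℕ.* a ℕ.+ 1 ≢ m ℕ.* (b ℕ.* b)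

  norm : ℕ → ℤ × ℤ → ℤ
  norm m (a , b) = a * a - + m * (b * b)

  norm-mulQ : ∀ m u v → norm m (mulQ m u v) ≡ norm m u * norm m v
  norm-mulQ m (a , b) (c , d) = multiplicative a b c d (+ m)
    where
    multiplicative : ∀ a b c d M →
      (a * c + M * (b * d)) * (a * c + M * (b * d)) - M * ((a * d + b * c) * (a * d + b * c))
        ≡ (a * a - M * (b * b)) * (c * c - M * (d * d))
    multiplicative = solve-∀

  norm-oneQ : ∀ m → norm m oneQ ≡ 1ℤ
  norm-oneQ m = identity (+ m)
    where
    identity : ∀ M → 1ℤ * 1ℤ - M * (0ℤ * 0ℤ) ≡ 1ℤ
    identity = solve-∀

  i*j≡1⇒i≡±1 : ∀ {i j} → i * j ≡ 1ℤ → i ≡ 1ℤ ⊎ i ≡ -1ℤ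
  i*j≡1⇒i≡±1 {i} {j} ij≡1 with ℕ.m*n≡1⇒m≡1 ∣ i ∣ ∣ j ∣ (trans (sym (ℤ.abs-* i j)) (cong ∣_∣ ij≡1))
  i*j≡1⇒i≡±1 {+ .1}     _ | refl = inj₁ refl
  i*j≡1⇒i≡±1 { -[1+ .0 ]} _ | refl = inj₂ refl

  unit⇒norm≡±1 : ∀ m u → IsUnitQ m u → norm m u ≡ 1ℤ ⊎ norm m u ≡ -1ℤ
  unit⇒norm≡±1 m u (v , uv≡1) = i*j≡1⇒i≡±1 (trans (sym (norm-mulQ m u v)) (trans (cong (norm m) uv≡1) (norm-oneQ m)))

  norm≡1⇒pell : ∀ m x y → norm m (x , y) ≡ 1ℤ → ∣ x ∣ ℕ.* ∣ x ∣ ≡ 1 ℕ.+ m ℕ.* (∣ y ∣ ℕ.* ∣ y ∣)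
  norm≡1⇒pell m x y N≡1 = ℤ.+-injective (begin
    + (∣ x ∣ ℕ.* ∣ x ∣)                   ≡⟨ i*i≡∣i∣*∣i∣ x ⟨
    x * x                                 ≡⟨ shuffle (x * x) (+ m * (y * y)) ⟩
    (x * x - + m * (y * y)) + + m * (y * y) ≡⟨ cong (_+ + m * (y * y)) N≡1 ⟩
    1ℤ + + m * (y * y)                    ≡⟨ cong (λ z → 1ℤ + + m * z) (i*i≡∣i∣*∣i∣ y) ⟩
    1ℤ + + m * + (∣ y ∣ ℕ.* ∣ y ∣)        ≡⟨ pos-+-* 1 m _ ⟨
    + (1 ℕ.+ m ℕ.* (∣ y ∣ ℕ.* ∣ y ∣))     ∎)
    where
    open ≡-Reasoning
    shuffle : ∀ A B → A ≡ (A - B) + B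
    shuffle = solve-∀

  norm≡-1⇒negative-pell : ∀ m x y → norm m (x , y) ≡ -1ℤ → ∣ x ∣ ℕ.* ∣ x ∣ ℕ.+ 1 ≡ m ℕ.* (∣ y ∣ ℕ.* ∣ y ∣)
  norm≡-1⇒negative-pell m x y N≡-1 = ℤ.+-injective (begin
    + (∣ x ∣ ℕ.* ∣ x ∣ ℕ.+ 1)                     ≡⟨ ℤ.pos-+ _ 1 ⟩
    + (∣ x ∣ ℕ.* ∣ x ∣) + 1ℤ                      ≡⟨ cong (_+ 1ℤ) (i*i≡∣i∣*∣i∣ x) ⟨
    x * x + 1ℤ                                    ≡⟨ shuffle (x * x) (+ m * (y * y)) ⟩
    (x * x - + m * (y * y)) + + m * (y * y) + 1ℤ   ≡⟨ cong (λ n → n + + m * (y * y) + 1ℤ) N≡-1 ⟩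
    -1ℤ + + m * (y * y) + 1ℤ                      ≡⟨ cancel (+ m * (y * y)) ⟩
    + m * (y * y)                                 ≡⟨ cong (+ m *_) (i*i≡∣i∣*∣i∣ y) ⟩
    + m * + (∣ y ∣ ℕ.* ∣ y ∣)                     ≡⟨ ℤ.pos-* m _ ⟨
    + (m ℕ.* (∣ y ∣ ℕ.* ∣ y ∣))                   ∎)
    where
    open ≡-Reasoning
    shuffle : ∀ A B → A + 1ℤ ≡ (A - B) + B + 1ℤ
    shuffle = solve-∀
    cancel : ∀ B → -1ℤ + B + 1ℤ ≡ B
    cancel = solve-∀

  -- The other sign patterns give x + y√m ≤ 1 or contradict x² − m y² = 1.
  norm≡1∧>1⇒positive : ∀ m x y → ∣ x ∣ ℕ.* ∣ x ∣ ≡ 1 ℕ.+ m ℕ.* (∣ y ∣ ℕ.* ∣ y ∣) → Gt1Q m (x , y) →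
    ∃[ X ] ∃[ Y ] x ≡ + X × y ≡ + Y × 0 ℕ.< Y
  norm≡1∧>1⇒positive m (+ zero) y () _
  norm≡1∧>1⇒positive m +[1+ n ] +[1+ k ] _ _ = suc n , suc k , refl , refl , z<s
  norm≡1∧>1⇒positive m +[1+ n ] (+ zero) pell (inj₁ (_ , _ , inj₁ (+<+ 0<n))) =
    ⊥-elim (ℕ.<-irrefl (sym pell′) (ℕ.*-mono-< (s≤s 0<n) (s≤s 0<n)))
    where
    pell′ : suc n ℕ.* suc n ≡ 1
    pell′ = trans pell (cong (1 ℕ.+_) (ℕ.*-zeroʳ m))
  norm≡1∧>1⇒positive m +[1+ n ] (+ zero) _ (inj₁ (_ , _ , inj₂ (+<+ ())))
  norm≡1∧>1⇒positive m +[1+ n ] (+ zero) _ (inj₂ (inj₁ (_ , +<+ () , _)))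
  norm≡1∧>1⇒positive m +[1+ n ] (+ zero) _ (inj₂ (inj₂ (+<+ () , _)))
  norm≡1∧>1⇒positive m +[1+ n ] -[1+ k ] _ (inj₁ (_ , () , _))
  norm≡1∧>1⇒positive m +[1+ n ] -[1+ k ] _ (inj₂ (inj₂ (+<+ () , _)))
  norm≡1∧>1⇒positive m +[1+ n ] -[1+ k ] pell (inj₂ (inj₁ (_ , _ , my²<n²))) =
    ⊥-elim (ℕ.<-irrefl refl (ℕ.<-≤-trans (ℕ.*-mono-< (ℕ.n<1+n n) (ℕ.n<1+n n)) (subst (ℕ._≤ n ℕ.* n) (sym pell) my²<n²′)))
    where
    my²<n²′ : m ℕ.* (suc k ℕ.* suc k) ℕ.< n ℕ.* n
    my²<n²′ = ℤ.drop‿+<+ (subst₂ ℤ._<_ (sym (ℤ.pos-* m _)) (trans (ℤ.*-identityˡ _) (sym (ℤ.pos-* n n))) my²<n²)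
  norm≡1∧>1⇒positive m -[1+ n ] y _ (inj₁ (() , _))
  norm≡1∧>1⇒positive m -[1+ n ] y _ (inj₂ (inj₁ (() , _)))
  norm≡1∧>1⇒positive m -[1+ n ] (+ zero) _ (inj₂ (inj₂ (_ , +<+ () , _)))
  norm≡1∧>1⇒positive m -[1+ n ] -[1+ k ] _ (inj₂ (inj₂ (_ , () , _)))
  norm≡1∧>1⇒positive m -[1+ n ] +[1+ k ] pell (inj₂ (inj₂ (_ , _ , [2+n]²<my²))) =
    ⊥-elim (ℕ.<-irrefl refl (ℕ.<-trans (ℕ.*-mono-< (ℕ.n<1+n (suc n)) (ℕ.n<1+n (suc n)))
      (ℕ.<-≤-trans [2+n]²<my²′ (ℕ.≤-trans (ℕ.n≤1+n _) (ℕ.≤-reflexive (sym pell))))))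
    where
    [2+n]²<my²′ : suc (suc n) ℕ.* suc (suc n) ℕ.< m ℕ.* (suc k ℕ.* suc k)
    [2+n]²<my²′ = subst (λ z → suc (suc z) ℕ.* suc (suc z) ℕ.< m ℕ.* (suc k ℕ.* suc k)) (ℕ.+-identityʳ n)
      (ℤ.drop‿+<+ (subst₂ ℤ._<_ (ℤ.*-identityˡ _) (sym (ℤ.pos-* m _)) [2+n]²<my²))

  mulQ-pos : ∀ m a b c d → mulQ m (+ a , + b) (+ c , + d) ≡ (+ (a ℕ.* c ℕ.+ m ℕ.* (b ℕ.* d)) , + (a ℕ.* d ℕ.+ b ℕ.* c))
  mulQ-pos m a b c d = cong₂ _,_
    (trans (cong (λ z → + a * + c + + m * z) (sym (ℤ.pos-* b d))) (sym (pos-*-+-* a c m (b ℕ.* d))))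
    (sym (pos-*-+-* a d b c))

  powQ-pos : ∀ m X Y → 0 ℕ.< X → ∀ n →
    ∃[ a ] ∃[ b ] powQ m (+ X , + Y) n ≡ (+ a , + b) × 0 ℕ.< a × (0 ℕ.< n → X ℕ.≤ a)
  powQ-pos m X Y 0<X zero = 1 , 0 , refl , z<s , λ ()
  powQ-pos m X Y 0<X (suc n) with powQ-pos m X Y 0<X n
  ... | a , b , εⁿ≡ , 0<a , _ =
    X ℕ.* a ℕ.+ m ℕ.* (Y ℕ.* b) , X ℕ.* b ℕ.+ Y ℕ.* a ,
    trans (cong (mulQ m (+ X , + Y)) εⁿ≡) (mulQ-pos m X Y a b) ,
    ℕ.<-≤-trans (ℕ.*-mono-≤ 0<X 0<a) (ℕ.m≤m+n _ _) ,
    λ _ → ℕ.≤-trans (ℕ.m≤m*n X a) (ℕ.m≤m+n _ _)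
    where instance _ = ℕ.>-nonZero 0<a

  pell⇒unit : ∀ m u v → u ℕ.* u ≡ 1 ℕ.+ m ℕ.* (v ℕ.* v) → IsUnitQ m (+ u , + v)
  pell⇒unit m u v pell = (+ u , - + v) , cong₂ _,_ (conjugate (+ u) (+ v) (+ m) pellℤ) (cross (+ u) (+ v))
    where
    pellℤ : + u * + u ≡ 1ℤ + + m * (+ v * + v)
    pellℤ = trans (sym (ℤ.pos-* u u)) (trans (cong +_ pell)
              (trans (pos-+-* 1 m (v ℕ.* v)) (cong (λ z → 1ℤ + + m * z) (ℤ.pos-* v v))))
    conjugate : ∀ U V M → U * U ≡ 1ℤ + M * (V * V) → U * U + M * (V * - V) ≡ 1ℤ
    conjugate U V M U²≡ = trans (shuffle U V M) (trans (cong (_- M * (V * V)) U²≡) (cancel V M))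
      where
      shuffle : ∀ U V M → U * U + M * (V * - V) ≡ U * U - M * (V * V)
      shuffle = solve-∀
      cancel : ∀ V M → 1ℤ + M * (V * V) - M * (V * V) ≡ 1ℤ
      cancel = solve-∀
    cross : ∀ U V → U * - V + V * U ≡ 0ℤ
    cross = solve-∀

  -- A positive solution u + v√m is a unit, hence ±ε^n or ±ε^(−n); only ε^n with n ≥ 1 survives the signs.
  fundamental⇒least : ∀ m X Y → 0 ℕ.< X → IsFundamentalUnit m (+ X , + Y) →
    ∀ {u v} → u ℕ.* u ≡ 1 ℕ.+ m ℕ.* (v ℕ.* v) → 0 ℕ.< v → X ℕ.≤ u
  fundamental⇒least m X Y 0<X (_ , _ , generates) {u} {v} pell 0<v
    with generates (+ u , + v) (pell⇒unit m u v pell)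
  ... | n , case with powQ-pos m X Y 0<X n
  ... | a , b , εⁿ≡ , 0<a , X≤a with n | case
  ...   | zero  | inj₁ u+v√m≡εⁿ = ⊥-elim (ℕ.<-irrefl (sym (ℤ.+-injective (cong proj₂ u+v√m≡εⁿ))) 0<v)
  ...   | suc _ | inj₁ u+v√m≡εⁿ = subst (X ℕ.≤_) (sym (ℤ.+-injective (cong proj₁ (trans u+v√m≡εⁿ εⁿ≡)))) (X≤a z<s)
  ...   | _ | inj₂ (inj₁ u+v√m≡-εⁿ) = ⊥-elim (u≢-a (cong proj₁ (trans u+v√m≡-εⁿ (cong negQ εⁿ≡))) 0<a)
    where
    u≢-a : ∀ {u a} → + u ≡ - + a → 0 ℕ.< a → ⊥
    u≢-a {a = suc _} () _
  ...   | _ | inj₂ (inj₂ (inj₁ uεⁿ≡1)) with ℕ.m+n≡0⇒n≡0 (u ℕ.* b) (ℤ.+-injective (cong proj₂ uεⁿ≡1′))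
    where
    uεⁿ≡1′ : (+ (u ℕ.* a ℕ.+ m ℕ.* (v ℕ.* b)) , + (u ℕ.* b ℕ.+ v ℕ.* a)) ≡ oneQ
    uεⁿ≡1′ = trans (sym (mulQ-pos m u v a b)) (trans (cong (mulQ m (+ u , + v)) (sym εⁿ≡)) uεⁿ≡1)
  ...     | va≡0 = ⊥-elim (ℕ.<-irrefl (sym va≡0) (ℕ.*-mono-< 0<v 0<a))
  fundamental⇒least m X Y 0<X (_ , _ , generates) {u} {v} pell 0<v
      | n , _ | a , b , εⁿ≡ , _ | _ | inj₂ (inj₂ (inj₂ uεⁿ≡-1)) = ⊥-elim (+≢-1 (cong proj₁ uεⁿ≡-1′))
    where
    uεⁿ≡-1′ : (+ (u ℕ.* a ℕ.+ m ℕ.* (v ℕ.* b)) , + (u ℕ.* b ℕ.+ v ℕ.* a)) ≡ negQ oneQ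
    uεⁿ≡-1′ = trans (sym (mulQ-pos m u v a b)) (trans (cong (mulQ m (+ u , + v)) (sym εⁿ≡)) uεⁿ≡-1)
    +≢-1 : ∀ {k} → + k ≢ -1ℤ
    +≢-1 ()

  positive-least-pell : ∀ {m x y} → IsFundamentalUnit m (x , y) → ∣ x ∣ ℕ.* ∣ x ∣ ≡ 1 ℕ.+ m ℕ.* (∣ y ∣ ℕ.* ∣ y ∣) →
    ∃[ X ] ∃[ Y ] x ≡ + X × y ≡ + Y × 0 ℕ.< Y → ∃[ X ] ∃[ Y ] x ≡ + X × y ≡ + Y × LeastPellSolution m X Y
  positive-least-pell {m} ε pell (suc X , Y , refl , refl , 0<Y) = suc X , Y , refl , refl , record
    { pell  = pell
    ; Y>0   = 0<Y
    ; least = fundamental⇒least m (suc X) Y z<s ε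
    }
  positive-least-pell ε () (zero , _ , refl , _)

  fundamental⇒least-pell : ∀ {m x y} → NegativePellInsoluble m → IsFundamentalUnit m (x , y) →
    ∃[ X ] ∃[ Y ] x ≡ + X × y ≡ + Y × LeastPellSolution m X Y
  fundamental⇒least-pell {m} {x} {y} no-negative ε@(unit , ε>1 , _) =
    [ (λ N≡1 → let pell = norm≡1⇒pell m x y N≡1 in positive-least-pell ε pell (norm≡1∧>1⇒positive m x y pell ε>1))
    , (λ N≡-1 → ⊥-elim (no-negative ∣ x ∣ ∣ y ∣ (norm≡-1⇒negative-pell m x y N≡-1)))
    ]′ (unit⇒norm≡±1 m (x , y) unit)

module PellParity where

  open PellUnits
  open import Data.Nat
  open import Data.Nat.Properties
  open import Data.Nat.Tactic.RingSolver using (solve-∀)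
  open import Data.Product using (∃-syntax; _×_)
  open import Data.Empty using (⊥)
  open import Relation.Binary.PropositionalEquality

  -- X + Y√(rs) = (u√r + v√s)², with r u² − s v² = 1.
  SqrtDecomposition : ℕ → ℕ → ℕ → ℕ → Set
  SqrtDecomposition r s X Y =
    ∃[ u ] ∃[ v ] X ≡ r * (u * u) + s * (v * v) × Y ≡ 2 * (u * v) × r * (u * u) ≡ 1 + s * (v * v)

  odd-pell : ∀ {m h Y} → (2 * h + 1) * (2 * h + 1) ≡ 1 + m * (Y * Y) → 4 * ((1 + h) * h) ≡ m * (Y * Y)
  odd-pell {h = h} pell = +-cancelˡ-≡ 1 _ _ (trans (sym (expand h)) pell)
    where
    expand : ∀ h → (2 * h + 1) * (2 * h + 1) ≡ 1 + 4 * ((1 + h) * h)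
    expand = solve-∀

  odd-even-pell : ∀ {m h z} → (2 * h + 1) * (2 * h + 1) ≡ 1 + m * ((2 * z) * (2 * z)) → (1 + h) * h ≡ m * (z * z)
  odd-even-pell {m} {h} {z} pell = *-cancelˡ-≡ _ _ 4 (trans (odd-pell {m} {h} {2 * z} pell) (regroup m z))
    where
    regroup : ∀ m z → m * ((2 * z) * (2 * z)) ≡ 4 * (m * (z * z))
    regroup = solve-∀

  even-pell : ∀ {m h Y} → (2 * (1 + h)) * (2 * (1 + h)) ≡ 1 + m * (Y * Y) → (2 * h + 1 + 2) * (2 * h + 1) ≡ m * (Y * Y)
  even-pell {h = h} pell = +-cancelˡ-≡ 1 _ _ (trans (sym (expand h)) pell)
    where
    expand : ∀ h → (2 * (1 + h)) * (2 * (1 + h)) ≡ 1 + (2 * h + 1 + 2) * (2 * h + 1)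
    expand = solve-∀

  -- If (X − 1)/2 = m v² and (X + 1)/2 = u², then u + v√m is a smaller solution than X.
  least-pell-half-square : ∀ {m h z u v} → 0 < m → LeastPellSolution m (2 * h + 1) (2 * z) →
    z ≡ u * v → suc h ≡ 1 * (u * u) → h ≡ m * (v * v) → ⊥
  least-pell-half-square {m} {h} {z} {u} {v} 0<m sol z≡uv 1+h≡u² h≡mv² =
    <-irrefl refl (<-≤-trans u<X (LeastPellSolution.least sol u²≡1+mv² 0<v))
    where
    u²≡1+mv² : u * u ≡ 1 + m * (v * v)
    u²≡1+mv² = trans (sym (*-identityˡ (u * u))) (trans (sym 1+h≡u²) (cong suc h≡mv²))
    0<v : 0 < v
    0<v = n≢0⇒n>0 λ v≡0 →
      <-irrefl (sym (cong (2 *_) (trans z≡uv (trans (cong (u *_) v≡0) (*-zeroʳ u))))) (LeastPellSolution.Y>0 sol)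
    0<h : 0 < h
    0<h = subst (0 <_) (sym h≡mv²) (*-mono-< 0<m (*-mono-< 0<v 0<v))
    u<X : u < 2 * h + 1
    u<X = begin-strict
      u          ≤⟨ m≤m*m u ⟩
      u * u      ≡⟨ trans (sym (*-identityˡ (u * u))) (sym 1+h≡u²) ⟩
      suc h      <⟨ m<m+n (suc h) 0<h ⟩
      suc h + h  ≡⟨ shuffle h ⟩
      2 * h + 1  ∎
      where
      open ≤-Reasoning
      shuffle : ∀ h → suc h + h ≡ 2 * h + 1
      shuffle = solve-∀
      m≤m*m : ∀ m → m ≤ m * m
      m≤m*m zero    = z≤n
      m≤m*m (suc m) = m≤m*n (suc m) (suc m)

open import Defs
open import Data.Nat as ℕ using (ℕ; _%_; zero; suc; z≤n; s≤s)
open import Data.Nat.Primality using (Prime)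
open import Relation.Binary.PropositionalEquality using (_≡_; refl; sym; trans; cong; cong₂; module ≡-Reasoning)

module FundamentalSolutions {p q : ℕ} (p-prime : Prime p) (q-prime : Prime q)
                            (p≡5 : p % 8 ≡ 5) (q≡7 : q % 8 ≡ 7) (legendre : LegendreOne p q) where

  open ResidueRefutation
  open QuadraticNonresidues
  open CoprimeFactorisation
  open PellUnits
  open LeastPellSolution using (pell)
  open PellParity
  open LegendreTransfer
  open import Data.Nat
  open import Data.Nat.Properties
  open import Data.Nat.Divisibility
  open import Data.Nat.Primality
  open import Data.Nat.ListAction using (product)
  open import Data.Nat.Tactic.RingSolver using (solve-∀)
  open import Data.Bool using (T; true; false; not)
  open import Data.List using ([]; _∷_; _++_)
  open import Data.List.Relation.Unary.All using ([]; _∷_)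
  open import Data.List.Relation.Binary.Pointwise using ([]; _∷_)
  open import Data.Vec using ([]; _∷_)
  open import Data.Integer using (+_)
  open import Data.Product using (∃-syntax; _×_; _,_)
  open import Data.Sum using (inj₁; inj₂)
  open import Data.Empty using (⊥; ⊥-elim)
  open import Relation.Binary.PropositionalEquality
  open import Relation.Nullary using (¬_)

  -- The environment of refute-mod-8 is u , v , p , q, with p ≡ 5 and q ≡ 7 (mod 8).
  𝑢 𝑣 𝑝 𝑞 : Expr
  𝑢 = var 0
  𝑣 = var 1
  𝑝 = var 2
  𝑞 = var 3

  refute-mod-8 : ∀ (L R : Expr) u v →
    T (all-residue-lists 2 8 (λ ys → not (⟦ L ⟧ (ys ++ 5 ∷ 7 ∷ []) % 8 ≡ᵇ ⟦ R ⟧ (ys ++ 5 ∷ 7 ∷ []) % 8))) →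
    ⟦ L ⟧ ((u ∷ v ∷ []) ++ p ∷ q ∷ []) ≢ ⟦ R ⟧ ((u ∷ v ∷ []) ++ p ∷ q ∷ [])
  refute-mod-8 L R u v = refute-mod 8 L R (u ∷ v ∷ []) (p ∷ q ∷ []) (p≡5 ∷ q≡7 ∷ [])

  q∤pv²+1 : ∀ v → ¬ q ∣ p * (v * v) + 1
  q∤pv²+1 v q∣pv²+1 =
    let w , q∣w²+1 = legendre-transfer legendre v 1 q∣pv²+1 in q≡7⇒q∤w²+1 w q-prime q≡7 q∣w²+1

  q∤pv²+2 : ∀ v → ¬ q ∣ p * (v * v) + 2
  q∤pv²+2 v q∣pv²+2 =
    let w , q∣w²+2 = legendre-transfer legendre v 2 q∣pv²+2 in q≡7⇒q∤w²+2 w q-prime q≡7 q∣w²+2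

  q∤2v²+1 : ∀ v → ¬ q ∣ 2 * (v * v) + 1
  q∤2v²+1 v q∣2v²+1 = q≡7⇒q∤w²+2 (2 * v) q-prime q≡7 (subst (q ∣_) (double v) (∣n⇒∣m*n 2 q∣2v²+1))
    where
    double : ∀ v → 2 * (2 * (v * v) + 1) ≡ 2 * v * (2 * v) + 2
    double = solve-∀

  negative-pell-2pq : NegativePellInsoluble (2 * p * q)
  negative-pell-2pq a b = refute-mod-8 (𝑢 ⊗ 𝑢 ⊕ con 1) (con 2 ⊗ 𝑝 ⊗ 𝑞 ⊗ (𝑣 ⊗ 𝑣)) a b _

  negative-pell-pq : NegativePellInsoluble (p * q)
  negative-pell-pq a b = refute-mod-8 (𝑢 ⊗ 𝑢 ⊕ con 1) (𝑝 ⊗ 𝑞 ⊗ (𝑣 ⊗ 𝑣)) a b _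

  -- The moduli as products of their prime factors, the form in which split pieces are reported.
  2pq pq : ℕ
  2pq = product (2 ∷ p ∷ q ∷ [])
  pq  = product (p ∷ q ∷ [])

  consecutive : ∀ {h a b} → suc h ≡ a → h ≡ b → a ≡ suc b
  consecutive A B = trans (sym A) (cong suc B)

  odd-difference : ∀ h {a b} → 2 * h + 1 + 2 ≡ a → 2 * h + 1 ≡ b → a ≡ b + 2
  odd-difference h A B = trans (sym A) (cong (_+ 2) B)

  -- The pattern of booleans records which of 2, p, q divide h + 1; all but one case is absurd.
  split-2pq : ∀ {h z} → LeastPellSolution 2pq (2 * h + 1) (2 * z) →
    SplitsIntoSquares (2 ∷ p ∷ q ∷ []) (suc h) h z → SqrtDecomposition (2 * p) q (2 * h + 1) (2 * z)
  split-2pq sol (false ∷ false ∷ false ∷ [] , u , v , A , B , z≡uv) =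
    ⊥-elim (least-pell-half-square {u = u} {v} (0<product (prime[2] ∷ p-prime ∷ q-prime ∷ [])) sol z≡uv A B)
  split-2pq sol (true ∷ false ∷ false ∷ [] , u , v , A , B , _) =
    ⊥-elim (refute-mod-8 (con 2 ⊗ con 1 ⊗ (𝑢 ⊗ 𝑢)) (con 1 ⊕ 𝑝 ⊗ (𝑞 ⊗ con 1) ⊗ (𝑣 ⊗ 𝑣)) u v _ (consecutive A B))
  split-2pq sol (false ∷ true ∷ false ∷ [] , u , v , A , B , _) =
    ⊥-elim (refute-mod-8 (𝑝 ⊗ con 1 ⊗ (𝑢 ⊗ 𝑢)) (con 1 ⊕ con 2 ⊗ (𝑞 ⊗ con 1) ⊗ (𝑣 ⊗ 𝑣)) u v _ (consecutive A B))
  split-2pq sol (false ∷ false ∷ true ∷ [] , u , v , A , B , _) =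
    ⊥-elim (refute-mod-8 (𝑞 ⊗ con 1 ⊗ (𝑢 ⊗ 𝑢)) (con 1 ⊕ con 2 ⊗ (𝑝 ⊗ con 1) ⊗ (𝑣 ⊗ 𝑣)) u v _ (consecutive A B))
  split-2pq sol (true ∷ true ∷ true ∷ [] , u , v , A , B , _) =
    ⊥-elim (refute-mod-8 (con 2 ⊗ (𝑝 ⊗ (𝑞 ⊗ con 1)) ⊗ (𝑢 ⊗ 𝑢)) (con 1 ⊕ con 1 ⊗ (𝑣 ⊗ 𝑣)) u v _ (consecutive A B))
  split-2pq sol (true ∷ false ∷ true ∷ [] , u , v , A , B , _) =
    ⊥-elim (q∤pv²+1 v (divides (2 * (u * u)) (trans (lhs p v) (trans (sym (consecutive A B)) (rhs q u)))))
    where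
    lhs : ∀ p v → p * (v * v) + 1 ≡ suc (p * 1 * (v * v))
    lhs = solve-∀
    rhs : ∀ q u → 2 * (q * 1) * (u * u) ≡ 2 * (u * u) * q
    rhs = solve-∀
  split-2pq sol (false ∷ true ∷ true ∷ [] , u , v , A , B , _) =
    ⊥-elim (q∤2v²+1 v (divides (p * (u * u)) (trans (lhs v) (trans (sym (consecutive A B)) (rhs p q u)))))
    where
    lhs : ∀ v → 2 * (v * v) + 1 ≡ suc (2 * 1 * (v * v))
    lhs = solve-∀
    rhs : ∀ p q u → p * (q * 1) * (u * u) ≡ p * (u * u) * q
    rhs = solve-∀
  split-2pq {h} sol (true ∷ true ∷ false ∷ [] , u , v , A , B , z≡uv) =
    u , v , trans (halves h) (cong₂ _+_ (trans A (r-part p u)) (trans B (s-part q v))) , cong (2 *_) z≡uv ,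
    trans (sym (r-part p u)) (trans (consecutive A B) (cong suc (s-part q v)))
    where
    halves : ∀ h → 2 * h + 1 ≡ suc h + h
    halves = solve-∀
    r-part : ∀ p u → 2 * (p * 1) * (u * u) ≡ 2 * p * (u * u)
    r-part = solve-∀
    s-part : ∀ q v → q * 1 * (v * v) ≡ q * (v * v)
    s-part = solve-∀

  decompose-2pq : ∀ {X Y} → LeastPellSolution 2pq X Y → SqrtDecomposition (2 * p) q X Y
  decompose-2pq {X} {Y} sol with even-or-odd X | even-or-odd Y
  ... | inj₁ (h , refl) | _ = ⊥-elim (refute-mod-8
          (con 2 ⊗ 𝑢 ⊗ (con 2 ⊗ 𝑢)) (con 1 ⊕ con 2 ⊗ (𝑝 ⊗ (𝑞 ⊗ con 1)) ⊗ (𝑣 ⊗ 𝑣)) h Y _ (pell sol))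
  ... | inj₂ (h , refl) | inj₂ (w , refl) = ⊥-elim (refute-mod-8
          (con 4 ⊗ ((con 1 ⊕ 𝑢) ⊗ 𝑢)) (con 2 ⊗ (𝑝 ⊗ (𝑞 ⊗ con 1)) ⊗ ((con 2 ⊗ 𝑣 ⊕ con 1) ⊗ (con 2 ⊗ 𝑣 ⊕ con 1)))
          h w _ (odd-pell {2pq} {h} {2 * w + 1} (pell sol)))
  ... | inj₂ (h , refl) | inj₁ (z , refl) = split-2pq sol
          (coprime-product-square-split (2 ∷ p ∷ q ∷ []) {z = z} (prime[2] ∷ p-prime ∷ q-prime ∷ []) (coprime-suc h)
            (odd-even-pell {2pq} {h} {z} (pell sol)))

  split-pq : ∀ {h z} → LeastPellSolution pq (2 * h + 1) (2 * z) →
    SplitsIntoSquares (p ∷ q ∷ []) (suc h) h z → SqrtDecomposition p q (2 * h + 1) (2 * z)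
  split-pq sol (false ∷ false ∷ [] , u , v , A , B , z≡uv) =
    ⊥-elim (least-pell-half-square {u = u} {v} (0<product (p-prime ∷ q-prime ∷ [])) sol z≡uv A B)
  split-pq sol (true ∷ true ∷ [] , u , v , A , B , _) =
    ⊥-elim (refute-mod-8 (𝑝 ⊗ (𝑞 ⊗ con 1) ⊗ (𝑢 ⊗ 𝑢)) (con 1 ⊕ con 1 ⊗ (𝑣 ⊗ 𝑣)) u v _ (consecutive A B))
  split-pq sol (false ∷ true ∷ [] , u , v , A , B , _) =
    ⊥-elim (q∤pv²+1 v (divides (u * u) (trans (lhs p v) (trans (sym (consecutive A B)) (rhs q u)))))
    where
    lhs : ∀ p v → p * (v * v) + 1 ≡ suc (p * 1 * (v * v))
    lhs = solve-∀
    rhs : ∀ q u → q * 1 * (u * u) ≡ u * u * q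
    rhs = solve-∀
  split-pq {h} sol (true ∷ false ∷ [] , u , v , A , B , z≡uv) =
    u , v , trans (halves h) (cong₂ _+_ (trans A (one-part p u)) (trans B (one-part q v))) , cong (2 *_) z≡uv ,
    trans (sym (one-part p u)) (trans (consecutive A B) (cong suc (one-part q v)))
    where
    halves : ∀ h → 2 * h + 1 ≡ suc h + h
    halves = solve-∀
    one-part : ∀ r u → r * 1 * (u * u) ≡ r * (u * u)
    one-part = solve-∀

  even-pq : ∀ {h Y} → SplitsIntoSquares (p ∷ q ∷ []) (2 * h + 1 + 2) (2 * h + 1) Y → ⊥
  even-pq {h} (false ∷ false ∷ [] , u , v , A , B , _) =
    refute-mod-8 (con 1 ⊗ (𝑢 ⊗ 𝑢)) (𝑝 ⊗ (𝑞 ⊗ con 1) ⊗ (𝑣 ⊗ 𝑣) ⊕ con 2) u v _ (odd-difference h A B)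
  even-pq {h} (true ∷ false ∷ [] , u , v , A , B , _) =
    refute-mod-8 (𝑝 ⊗ con 1 ⊗ (𝑢 ⊗ 𝑢)) (𝑞 ⊗ con 1 ⊗ (𝑣 ⊗ 𝑣) ⊕ con 2) u v _ (odd-difference h A B)
  even-pq {h} (false ∷ true ∷ [] , u , v , A , B , _) =
    q∤pv²+2 v (divides (u * u) (trans (lhs p v) (trans (sym (odd-difference h A B)) (rhs q u))))
    where
    lhs : ∀ p v → p * (v * v) + 2 ≡ p * 1 * (v * v) + 2
    lhs = solve-∀
    rhs : ∀ q u → q * 1 * (u * u) ≡ u * u * q
    rhs = solve-∀
  even-pq {h} (true ∷ true ∷ [] , u , v , A , B , _) =
    q≡7⇒q∤w²+2 v q-prime q≡7 (divides (p * (u * u)) (trans (lhs v) (trans (sym (odd-difference h A B)) (rhs p q u))))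
    where
    lhs : ∀ v → v * v + 2 ≡ 1 * (v * v) + 2
    lhs = solve-∀
    rhs : ∀ p q u → p * (q * 1) * (u * u) ≡ p * (u * u) * q
    rhs = solve-∀

  decompose-pq : ∀ {X Y} → LeastPellSolution pq X Y → SqrtDecomposition p q X Y
  decompose-pq {X} {Y} sol with even-or-odd X | even-or-odd Y
  ... | inj₁ (zero , refl) | _ = ⊥-elim (0≢1+n (pell sol))
  ... | inj₁ (suc h , refl) | _ = ⊥-elim (even-pq {h}
          (coprime-product-square-split (p ∷ q ∷ []) {z = Y} (p-prime ∷ q-prime ∷ []) (coprime-odd-+2 h)
            (even-pell {pq} {h} {Y} (pell sol))))
  ... | inj₂ (h , refl) | inj₂ (w , refl) = ⊥-elim (refute-mod-8
          (con 4 ⊗ ((con 1 ⊕ 𝑢) ⊗ 𝑢)) (𝑝 ⊗ (𝑞 ⊗ con 1) ⊗ ((con 2 ⊗ 𝑣 ⊕ con 1) ⊗ (con 2 ⊗ 𝑣 ⊕ con 1)))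
          h w _ (odd-pell {pq} {h} {2 * w + 1} (pell sol)))
  ... | inj₂ (h , refl) | inj₁ (z , refl) = split-pq sol
          (coprime-product-square-split (p ∷ q ∷ []) {z = z} (p-prime ∷ q-prime ∷ []) (coprime-suc h)
            (odd-even-pell {pq} {h} {z} (pell sol)))

  least-pell-2pq : ∀ {X Y} → LeastPellSolution (2 * p * q) X Y → SqrtDecomposition (2 * p) q X Y
  least-pell-2pq {X} {Y} sol = decompose-2pq (subst (λ m → LeastPellSolution m X Y) (regroup p q) sol)
    where
    regroup : ∀ p q → 2 * p * q ≡ 2 * (p * (q * 1))
    regroup = solve-∀

  least-pell-pq : ∀ {X Y} → LeastPellSolution (p * q) X Y → SqrtDecomposition p q X Y
  least-pell-pq {X} {Y} sol = decompose-pq (subst (λ m → LeastPellSolution m X Y) (cong (p *_) (sym (*-identityʳ q))) sol)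

  fundamental-2pq : ∀ {x y} → IsFundamentalUnit (2 * p * q) (x , y) →
    ∃[ X ] ∃[ Y ] x ≡ + X × y ≡ + Y × SqrtDecomposition (2 * p) q X Y
  fundamental-2pq ε = decompose (fundamental⇒least-pell negative-pell-2pq ε)
    where
    decompose : ∀ {x y} → ∃[ X ] ∃[ Y ] x ≡ + X × y ≡ + Y × LeastPellSolution (2 * p * q) X Y →
                ∃[ X ] ∃[ Y ] x ≡ + X × y ≡ + Y × SqrtDecomposition (2 * p) q X Y
    decompose (X , Y , x≡X , y≡Y , sol) = X , Y , x≡X , y≡Y , least-pell-2pq sol

  fundamental-pq : ∀ {x y} → IsFundamentalUnit (p * q) (x , y) →
    ∃[ X ] ∃[ Y ] x ≡ + X × y ≡ + Y × SqrtDecomposition p q X Y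
  fundamental-pq ε = decompose (fundamental⇒least-pell negative-pell-pq ε)
    where
    decompose : ∀ {x y} → ∃[ X ] ∃[ Y ] x ≡ + X × y ≡ + Y × LeastPellSolution (p * q) X Y →
                ∃[ X ] ∃[ Y ] x ≡ + X × y ≡ + Y × SqrtDecomposition p q X Y
    decompose (X , Y , x≡X , y≡Y , sol) = X , Y , x≡X , y≡Y , least-pell-pq sol

open import Data.Nat.Properties using (*-assoc)
open import Data.Nat.Tactic.RingSolver using (solve-∀)
open import Data.Integer using (ℤ; +_; _+_; _-_; _*_; 1ℤ; +≤+; +<+)
open import Data.Integer.Properties using (pos-*)
open import Data.Product using (_×_; _,_; ∃-syntax)
open import Data.Sum using (inj₁; inj₂)
open NatEmbedding using (pos-*-+1; pos-weighted-square; pos-difference)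
open PellParity using (SqrtDecomposition)

nonnegComb-+ : ∀ r s a b → NonnegComb r s (+ a) (+ b)
nonnegComb-+ r s (suc a) b     = inj₁ (inj₁ (+≤+ z≤n , +≤+ z≤n , inj₁ (+<+ (s≤s z≤n))))
nonnegComb-+ r s zero (suc b)  = inj₁ (inj₁ (+≤+ z≤n , +≤+ z≤n , inj₂ (+<+ (s≤s z≤n))))
nonnegComb-+ r s zero zero     = inj₂ (refl , refl)

sqrt-2ε-2pq : ∀ {p q x y} → ∃[ X ] ∃[ Y ] x ≡ + X × y ≡ + Y × SqrtDecomposition (2 ℕ.* p) q X Y →
  IsSquareℕ (+ p * (x + 1ℤ))
  × (∃[ y₁ ] ∃[ y₂ ] ((+ 2 * x ≡ + p * (y₁ * y₁) + + (2 ℕ.* q) * (y₂ * y₂) × y ≡ y₁ * y₂ × NonnegComb p (2 ℕ.* q) y₁ y₂)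
      × + 2 ≡ + p * (y₁ * y₁) - + (2 ℕ.* q) * (y₂ * y₂)))
sqrt-2ε-2pq {p} {q} (_ , _ , refl , refl , u , v , refl , refl , 2pu²≡1+qv²) =
  (2 ℕ.* p ℕ.* u , trans (pos-*-+1 p _) (cong +_ p[x+1]≡[2pu]²)) ,
  + (2 ℕ.* u) , + v ,
  ( trans (sym (pos-* 2 (2 ℕ.* p ℕ.* (u ℕ.* u) ℕ.+ q ℕ.* (v ℕ.* v))))
      (trans (cong +_ (double p q u v)) (cong₂ _+_ (pos-weighted-square p (2 ℕ.* u)) (pos-weighted-square (2 ℕ.* q) v)))
  , trans (cong +_ (sym (*-assoc 2 u v))) (pos-* (2 ℕ.* u) v)
  , nonnegComb-+ p (2 ℕ.* q) (2 ℕ.* u) v ) ,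
  trans (pos-difference 4pu²≡2+2qv²) (cong₂ _-_ (pos-weighted-square p (2 ℕ.* u)) (pos-weighted-square (2 ℕ.* q) v))
  where
  open ≡-Reasoning
  double : ∀ p q u v → 2 ℕ.* (2 ℕ.* p ℕ.* (u ℕ.* u) ℕ.+ q ℕ.* (v ℕ.* v)) ≡ p ℕ.* (2 ℕ.* u ℕ.* (2 ℕ.* u)) ℕ.+ 2 ℕ.* q ℕ.* (v ℕ.* v)
  double = solve-∀
  p[x+1]≡[2pu]² : p ℕ.* (2 ℕ.* p ℕ.* (u ℕ.* u) ℕ.+ q ℕ.* (v ℕ.* v) ℕ.+ 1) ≡ 2 ℕ.* p ℕ.* u ℕ.* (2 ℕ.* p ℕ.* u)
  p[x+1]≡[2pu]² = begin
    p ℕ.* (2 ℕ.* p ℕ.* (u ℕ.* u) ℕ.+ q ℕ.* (v ℕ.* v) ℕ.+ 1)   ≡⟨ cong (p ℕ.*_) (shift (2 ℕ.* p ℕ.* (u ℕ.* u)) (q ℕ.* (v ℕ.* v))) ⟩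
    p ℕ.* (2 ℕ.* p ℕ.* (u ℕ.* u) ℕ.+ (1 ℕ.+ q ℕ.* (v ℕ.* v))) ≡⟨ cong (λ n → p ℕ.* (2 ℕ.* p ℕ.* (u ℕ.* u) ℕ.+ n)) 2pu²≡1+qv² ⟨
    p ℕ.* (2 ℕ.* p ℕ.* (u ℕ.* u) ℕ.+ 2 ℕ.* p ℕ.* (u ℕ.* u))   ≡⟨ square p u ⟩
    2 ℕ.* p ℕ.* u ℕ.* (2 ℕ.* p ℕ.* u)                          ∎
    where
    shift : ∀ a b → a ℕ.+ b ℕ.+ 1 ≡ a ℕ.+ (1 ℕ.+ b)
    shift = solve-∀
    square : ∀ p u → p ℕ.* (2 ℕ.* p ℕ.* (u ℕ.* u) ℕ.+ 2 ℕ.* p ℕ.* (u ℕ.* u)) ≡ 2 ℕ.* p ℕ.* u ℕ.* (2 ℕ.* p ℕ.* u)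
    square = solve-∀
  4pu²≡2+2qv² : p ℕ.* (2 ℕ.* u ℕ.* (2 ℕ.* u)) ≡ 2 ℕ.+ 2 ℕ.* q ℕ.* (v ℕ.* v)
  4pu²≡2+2qv² = begin
    p ℕ.* (2 ℕ.* u ℕ.* (2 ℕ.* u))   ≡⟨ twice p u ⟩
    2 ℕ.* (2 ℕ.* p ℕ.* (u ℕ.* u))   ≡⟨ cong (2 ℕ.*_) 2pu²≡1+qv² ⟩
    2 ℕ.* (1 ℕ.+ q ℕ.* (v ℕ.* v))   ≡⟨ distribute q v ⟩
    2 ℕ.+ 2 ℕ.* q ℕ.* (v ℕ.* v)     ∎
    where
    twice : ∀ p u → p ℕ.* (2 ℕ.* u ℕ.* (2 ℕ.* u)) ≡ 2 ℕ.* (2 ℕ.* p ℕ.* (u ℕ.* u))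
    twice = solve-∀
    distribute : ∀ q v → 2 ℕ.* (1 ℕ.+ q ℕ.* (v ℕ.* v)) ≡ 2 ℕ.+ 2 ℕ.* q ℕ.* (v ℕ.* v)
    distribute = solve-∀

sqrt-ε-pq : ∀ {p q a b} → ∃[ X ] ∃[ Y ] a ≡ + X × b ≡ + Y × SqrtDecomposition p q X Y →
  IsSquareℕ (+ (2 ℕ.* p) * (a + 1ℤ))
  × (∃[ b₁ ] ∃[ b₂ ] ((a ≡ + p * (b₁ * b₁) + + q * (b₂ * b₂) × b ≡ + 2 * (b₁ * b₂) × NonnegComb p q b₁ b₂)
      × 1ℤ ≡ + p * (b₁ * b₁) - + q * (b₂ * b₂)))
sqrt-ε-pq {p} {q} (_ , _ , refl , refl , u , v , refl , refl , pu²≡1+qv²) =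
  (2 ℕ.* p ℕ.* u , trans (pos-*-+1 (2 ℕ.* p) _) (cong +_ 2p[a+1]≡[2pu]²)) ,
  + u , + v ,
  ( cong₂ _+_ (pos-weighted-square p u) (pos-weighted-square q v)
  , trans (pos-* 2 (u ℕ.* v)) (cong (+ 2 *_) (pos-* u v))
  , nonnegComb-+ p q u v ) ,
  trans (pos-difference pu²≡1+qv²) (cong₂ _-_ (pos-weighted-square p u) (pos-weighted-square q v))
  where
  open ≡-Reasoning
  2p[a+1]≡[2pu]² : 2 ℕ.* p ℕ.* (p ℕ.* (u ℕ.* u) ℕ.+ q ℕ.* (v ℕ.* v) ℕ.+ 1) ≡ 2 ℕ.* p ℕ.* u ℕ.* (2 ℕ.* p ℕ.* u)
  2p[a+1]≡[2pu]² = begin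
    2 ℕ.* p ℕ.* (p ℕ.* (u ℕ.* u) ℕ.+ q ℕ.* (v ℕ.* v) ℕ.+ 1)   ≡⟨ cong (2 ℕ.* p ℕ.*_) (shift (p ℕ.* (u ℕ.* u)) (q ℕ.* (v ℕ.* v))) ⟩
    2 ℕ.* p ℕ.* (p ℕ.* (u ℕ.* u) ℕ.+ (1 ℕ.+ q ℕ.* (v ℕ.* v))) ≡⟨ cong (λ n → 2 ℕ.* p ℕ.* (p ℕ.* (u ℕ.* u) ℕ.+ n)) pu²≡1+qv² ⟨
    2 ℕ.* p ℕ.* (p ℕ.* (u ℕ.* u) ℕ.+ p ℕ.* (u ℕ.* u))         ≡⟨ square p u ⟩
    2 ℕ.* p ℕ.* u ℕ.* (2 ℕ.* p ℕ.* u)                          ∎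
    where
    shift : ∀ a b → a ℕ.+ b ℕ.+ 1 ≡ a ℕ.+ (1 ℕ.+ b)
    shift = solve-∀
    square : ∀ p u → 2 ℕ.* p ℕ.* (p ℕ.* (u ℕ.* u) ℕ.+ p ℕ.* (u ℕ.* u)) ≡ 2 ℕ.* p ℕ.* u ℕ.* (2 ℕ.* p ℕ.* u)
    square = solve-∀

mainTheorem1 : (p q : ℕ) → Prime p → Prime q → p % 8 ≡ 5 → q % 8 ≡ 7 → LegendreOne p q →
    ((x y : ℤ) → IsFundamentalUnit (2 ℕ.* p ℕ.* q) (x , y) →
      IsSquareℕ (+ p * (x + 1ℤ))
      × (∃[ y₁ ] ∃[ y₂ ] ((+ 2 * x ≡ + p * (y₁ * y₁) + + (2 ℕ.* q) * (y₂ * y₂) × y ≡ y₁ * y₂ × NonnegComb p (2 ℕ.* q) y₁ y₂)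
          × + 2 ≡ + p * (y₁ * y₁) - + (2 ℕ.* q) * (y₂ * y₂))))
    × ((a b : ℤ) → IsFundamentalUnit (p ℕ.* q) (a , b) →
      IsSquareℕ (+ (2 ℕ.* p) * (a + 1ℤ))
      × (∃[ b₁ ] ∃[ b₂ ] ((a ≡ + p * (b₁ * b₁) + + q * (b₂ * b₂) × b ≡ + 2 * (b₁ * b₂) × NonnegComb p q b₁ b₂)
          × 1ℤ ≡ + p * (b₁ * b₁) - + q * (b₂ * b₂))))
mainTheorem1 p q p-prime q-prime p≡5 q≡7 legendre =
  (λ x y ε → sqrt-2ε-2pq {p} {q} (fundamental-2pq ε)) , (λ a b ε → sqrt-ε-pq {p} {q} (fundamental-pq ε))
  where open FundamentalSolutions p-prime q-prime p≡5 q≡7 legendre using (fundamental-2pq; fundamental-pq)
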